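{- Let $G=(V,E)$ be a finite, connected, undirected graph (multiple edges allowed) with at least one edge, let $\eta^*$ be the optimal edge usage probabilities for the Fairest Edge Usage problem on $G$, let $\eta^*_{\max}=\max_{e\in E}\eta^*(e)$ and $E^*=\{e\in E:\eta^*(e)=\eta^*_{\max}\}$. Then $\eta^*_{\max}=\theta(E^*)$.
   Context: $\Gamma$ denotes the set of spanning trees of $G$, each viewed as a set of edges. For a probability mass function (pmf) $\mu$ on $\Gamma$, its edge usage probabilities are $\eta(e)=\sum_{\gamma\in\Gamma:\,e\in\gamma}\mu(\gamma)$. The Fairest Edge Usage problem is to minimize $\sum_{e\in E}\eta(e)^2$ over all pmfs $\mu$ on $\Gamma$; all minimizers induce the same edge usage probabilities, denoted $\eta^*$. For $J\subseteq E$, $\mathcal{M}(J)=\min_{\gamma\in\Gamma}|\gamma\cap J|$, and the vulnerability of $J$ is $\theta(J)=\mathcal{M}(J)/|J|$ if $J\neq\emptyset$ and $\theta(\emptyset)=0$.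
   Formalization: The pmfs on Γ take rational values, and optimality for the Fairest Edge Usage problem is taken among rational pmfs only. -}

module Defs where

open import Data.Nat as ℕ using (ℕ; zero; suc)
open import Data.Fin using (Fin; zero; suc)
open import Data.Product using (_×_; _,_; ∃; ∃-syntax; proj₁; proj₂)
open import Data.Sum using (_⊎_)
open import Data.List using (List; []; _∷_; foldr; map)
open import Data.List.Relation.Unary.All using (All)
open import Data.List.Relation.Unary.Unique.Propositional using (Unique)
open import Data.Vec using (lookup; tabulate)
open import Data.Vec.Functional as VF using ()
open import Data.Fin.Subset using (Subset; _∈_; _∩_; ∣_∣; ⊤)
open import Data.Bool using (if_then_else_)
open import Data.Integer using (+_)
open import Data.Rational using (ℚ; 0ℚ; _+_; _*_; _⊔_; _≤_; _/_)
open import Data.Rational.Properties using (_≟_)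
open import Relation.Binary.PropositionalEquality using (_≡_; _≢_)
open import Relation.Nullary using (¬_; does)

-- A finite undirected multigraph on vertex set Fin n with edge set Fin m;
-- edge e joins the two endpoints  ends e  (parallel edges allowed).
Ends : ℕ → ℕ → Set
Ends n m = Fin m → Fin n × Fin n

NoLoops : {n m : ℕ} → Ends n m → Set
NoLoops ends = ∀ e → proj₁ (ends e) ≢ proj₂ (ends e)

module _ {n m : ℕ} (ends : Ends n m) where

  Joins : Fin m → Fin n → Fin n → Set
  Joins e u w = (ends e ≡ (u , w)) ⊎ (ends e ≡ (w , u))

  data Walk (T : Subset m) : Fin n → Fin n → List (Fin m) → Set where
    nil  : ∀ {u} → Walk T u u []
    cons : ∀ {u w v e es} → e ∈ T → Joins e u w → Walk T w v es →
           Walk T u v (e ∷ es)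

  ConnectedSub : Subset m → Set
  ConnectedSub T = ∀ u v → ∃[ es ] Walk T u v es

  Acyclic : Subset m → Set
  Acyclic T = ∀ u es → Walk T u u es → Unique es → es ≡ []

  Connected : Set
  Connected = ConnectedSub ⊤

  SpanningTree : Subset m → Set
  SpanningTree T = ConnectedSub T × Acyclic T

  -- A pmf on Γ, given by a finite list of (spanning tree, probability)
  -- pairs with nonnegative weights summing to 1 (repetitions allowed; the
  -- mass of a tree is the total weight of its occurrences).
  sumℚ : List ℚ → ℚ
  sumℚ = foldr _+_ 0ℚ

  IsPMF : List (Subset m × ℚ) → Set
  IsPMF μ = All (λ p → SpanningTree (proj₁ p) × 0ℚ ≤ proj₂ p) μ
          × sumℚ (map proj₂ μ) ≡ + 1 / 1

  η : List (Subset m × ℚ) → Fin m → ℚ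
  η μ e = sumℚ (map (λ p → if lookup (proj₁ p) e then proj₂ p else 0ℚ) μ)

  sumE : (Fin m → ℚ) → ℚ
  sumE f = VF.foldr _+_ 0ℚ f

  cost : List (Subset m × ℚ) → ℚ
  cost μ = sumE (λ e → η μ e * η μ e)

  Optimal : List (Subset m × ℚ) → Set
  Optimal μ = IsPMF μ × (∀ ν → IsPMF ν → cost μ ≤ cost ν)

  IsMinCover : Subset m → ℕ → Set
  IsMinCover J k = (∃[ T ] SpanningTree T × ∣ T ∩ J ∣ ≡ k)
                 × (∀ T → SpanningTree T → k ℕ.≤ ∣ T ∩ J ∣)

-- k / d as a rational, with the convention value 0 when d = 0
ratio : ℕ → ℕ → ℚ
ratio k zero    = 0ℚ
ratio k (suc d) = + k / suc d

-- θ(J) = 𝓜(J)/|J|, and θ(∅) = 0, given k = 𝓜(J)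
θ : {m : ℕ} → Subset m → ℕ → ℚ
θ J k = ratio k ∣ J ∣

maxE : {m : ℕ} → (Fin (suc m) → ℚ) → ℚ
maxE {m} f = VF.foldr _⊔_ (f zero) f

argmaxSet : {m : ℕ} → (Fin m → ℚ) → ℚ → Subset m
argmaxSet f M = tabulate (λ e → does (f e ≟ M))

{-# OPTIONS --safe #-}
-- Weigh each edge e by η*(e) and a spanning tree by the total weight of its edges.
-- Shifting mass ε from a tree γ in the support of an optimal μ onto any tree τ
-- changes the cost by ε (2 (w τ − w γ) + ε D) with D ≥ 0, so every tree in the
-- support has minimum weight. A minimum weight tree γ meets E* in at most 𝓜(E*)
-- edges: take a tree T realising 𝓜(E*) and an edge e ∈ γ ∩ E* outside T; basis
-- exchange gives f ∈ T ∖ γ with γ − e + f a spanning tree, minimality forces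
-- η*(f) ≥ η*(e) = η*_max, so f ∈ E* and γ − e + f is again of minimum weight,
-- meets E* as often as γ and is closer to T. Hence
-- η*_max |E*| = Σ_{e ∈ E*} η*(e) = Σ_γ μ(γ) |γ ∩ E*| = 𝓜(E*).
module Submission where

open import Defs
open import Algebra.Bundles using (CommutativeMonoid; Ring)
open import Data.Bool using (Bool; true; false; if_then_else_; _∧_)
open import Data.Bool.Properties using (¬-not)
open import Data.Empty using (⊥-elim)
open import Data.Fin using (Fin; zero; suc; punchIn)
open import Data.Fin.Properties using (punchInᵢ≢i) renaming (_≟_ to _≟ᶠ_)
open import Data.Fin.Subset using (Subset; _∈_; _∉_; _⊆_; _∩_; ∁; ∣_∣; inside; outside)
open import Data.Fin.Subset.Properties
  using ( _∈?_; nonempty?; ∩-comm; p⊆q⇒∣p∣≤∣q∣; ∣⁅x⁆∣≡1; x∈⁅y⁆⇒x≡y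
        ; x∈p∩q⁺; x∈p∩q⁻; x∉p⇒x∈∁p; x∈∁p⇒x∉p; x∈p⇒x∉∁p)
open import Data.Integer as ℤ using (+_)
open import Data.Integer.Tactic.RingSolver using (solve-∀)
open import Data.List using (List; []; _∷_; _++_; map)
open import Data.List.Properties using (map-++; map-cong-local)
open import Data.List.Membership.Propositional using () renaming (_∈_ to _∈ₗ_; _∉_ to _∉ₗ_)
open import Data.List.Membership.Propositional.Properties using (∈-∃++)
open import Data.List.Relation.Unary.All as All using (All; []; _∷_)
import Data.List.Relation.Unary.All.Properties as All
open import Data.List.Relation.Unary.Unique.Propositional using (Unique; []; _∷_)
open import Data.List.Relation.Unary.Unique.Propositional.Properties using (Unique[x∷xs]⇒x∉xs)
import Data.List.Relation.Binary.Permutation.Setoid.Properties as Permutation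
open import Data.Nat as ℕ using (ℕ; zero; suc)
import Data.Nat.Properties as ℕ
open import Data.Nat.Induction using (<-wellFounded)
open import Data.Product using (_×_; _,_; ∃-syntax; proj₁; proj₂)
open import Data.Rational
  using ( ℚ; 0ℚ; 1ℚ; _+_; _*_; -_; _-_; _/_; 1/_; _⊔_; _⊓_; _≤_; _<_; toℚᵘ
        ; Positive; NonZero; positive; nonNegative)
open import Data.Rational.Properties
open import Algebra.Properties.Group +-0-group using () renaming (∙-cancelʳ to +-cancelʳ-≡)
open import Data.Rational.Solver using (module +-*-Solver)
open import Data.Rational.Unnormalised as ℚᵘ using (mkℚᵘ; *≡*)
import Data.Rational.Unnormalised.Properties as ℚᵘ
open import Data.Sum as Sum using (_⊎_; inj₁; inj₂)
open import Data.Vec using (_∷_; []; lookup; _[_]≔_)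
open import Data.Vec.Properties
  using ( lookup∘tabulate; lookup∘update; lookup∘update′; lookup-zipWith
        ; []=⇒lookup; lookup⇒[]=; []≔-updates; []≔-minimal; []=-injective)
import Data.Vec.Functional as Vector
open import Function using (_∘_)
open import Induction.WellFounded using (Acc; acc)
open import Relation.Binary.Definitions using (tri<; tri≈; tri>)
open import Relation.Binary.PropositionalEquality
  using (_≡_; _≢_; refl; sym; trans; cong; cong₂; subst; subst₂; module ≡-Reasoning)
import Relation.Binary.PropositionalEquality as ≡
open import Relation.Nullary using (¬_; yes; no; does; contradiction)
open import Relation.Nullary.Decidable using (decidable-stable; dec-true; ¬¬-excluded-middle)


∉⇒lookup≡false : {m : ℕ} {S : Subset m} {x : Fin m} → x ∉ S → lookup S x ≡ false
∉⇒lookup≡false {S = S} {x} x∉S = ¬-not (x∉S ∘ lookup⇒[]= x S)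

∈∉⇒≢ : {m : ℕ} {S : Subset m} {x y : Fin m} → x ∈ S → y ∉ S → x ≢ y
∈∉⇒≢ x∈S y∉S refl = y∉S x∈S

∈⇒0<∣∣ : {m : ℕ} {S : Subset m} {x : Fin m} → x ∈ S → 0 ℕ.< ∣ S ∣
∈⇒0<∣∣ {S = S} {x} x∈S =
  subst (ℕ._≤ ∣ S ∣) (∣⁅x⁆∣≡1 x)
        (p⊆q⇒∣p∣≤∣q∣ λ y∈⁅x⁆ → subst (_∈ S) (sym (x∈⁅y⁆⇒x≡y x y∈⁅x⁆)) x∈S)

module _ {m : ℕ} {S : Subset m} where

  ∈-update⁺ : ∀ {x i b} → x ≢ i → x ∈ S → x ∈ S [ i ]≔ b
  ∈-update⁺ {x} {i} x≢i = []≔-minimal S x i x≢i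

  ∈-update⁻ : ∀ {x i b} → x ≢ i → x ∈ S [ i ]≔ b → x ∈ S
  ∈-update⁻ {x} {i} {b} x≢i x∈ = lookup⇒[]= x S (trans (sym (lookup∘update′ x≢i S b)) ([]=⇒lookup x∈))

  ∈-update-inside : ∀ i → i ∈ S [ i ]≔ inside
  ∈-update-inside i = []≔-updates S i

  ∉-update-outside : ∀ i → i ∉ S [ i ]≔ outside
  ∉-update-outside i i∈ with []=-injective ([]≔-updates S i) i∈
  ... | ()

swap : {m : ℕ} → Subset m → Fin m → Fin m → Subset m
swap S e f = S [ e ]≔ outside [ f ]≔ inside

module _ {m : ℕ} (f : Fin m → ℚ) {M : ℚ} {x : Fin m} where

  ∈-argmaxSet⁻ : x ∈ argmaxSet f M → f x ≡ M
  ∈-argmaxSet⁻ x∈ with f x ≟ M | trans (sym (lookup∘tabulate (λ e → does (f e ≟ M)) x)) ([]=⇒lookup x∈)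
  ... | yes fx≡M | _  = fx≡M
  ... | no  _    | ()

  ∈-argmaxSet⁺ : f x ≡ M → x ∈ argmaxSet f M
  ∈-argmaxSet⁺ fx≡M =
    lookup⇒[]= x (argmaxSet f M) (trans (lookup∘tabulate (λ e → does (f e ≟ M)) x) (dec-true (f x ≟ M) fx≡M))

module SubsetSum {c ℓ} (M : CommutativeMonoid c ℓ) where

  open CommutativeMonoid M
    using (Carrier; _≈_; _∙_; ε; ∙-congˡ; ∙-congʳ; identityʳ; setoid)
    renaming (refl to ≈-refl; sym to ≈-sym; trans to ≈-trans; reflexive to ≈-reflexive)
  open import Algebra.Properties.CommutativeMonoid.Sum M
    using (sum; sum-remove; sum-cong-≋; sum-cong-≗; ∑-distrib-+; sum-replicate-zero)
  open import Algebra.Solver.CommutativeMonoid M using (solve; _⊕_; _⊜_)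
  open import Relation.Binary.Reasoning.Setoid setoid

  sum-agree-off : {n : ℕ} {t u : Fin n → Carrier} (i : Fin n) →
                  (∀ j → j ≢ i → t j ≈ u j) → sum t ∙ u i ≈ sum u ∙ t i
  sum-agree-off {suc n} {t} {u} i t≈u = begin
    sum t ∙ u i                        ≈⟨ ∙-congʳ (sum-remove {i = i} t) ⟩
    (t i ∙ sum (removeAt t)) ∙ u i     ≈⟨ ∙-congʳ (∙-congˡ (sum-cong-≋ (λ j → t≈u _ (punchInᵢ≢i i j)))) ⟩
    (t i ∙ sum (removeAt u)) ∙ u i     ≈⟨ solve 3 (λ x s y → (x ⊕ s) ⊕ y ⊜ (y ⊕ s) ⊕ x) ≈-refl (t i) _ (u i) ⟩
    (u i ∙ sum (removeAt u)) ∙ t i     ≈⟨ ∙-congʳ (≈-sym (sum-remove {i = i} u)) ⟩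
    sum u ∙ t i                        ∎
    where
    removeAt : (Fin (suc n) → Carrier) → Fin n → Carrier
    removeAt v j = v (punchIn i j)

  ∑∈ : {m : ℕ} → Subset m → (Fin m → Carrier) → Carrier
  ∑∈ S w = sum (λ x → if lookup S x then w x else ε)

  ∑∈-cong : {m : ℕ} {S : Subset m} {v w : Fin m → Carrier} → (∀ {x} → x ∈ S → v x ≈ w x) → ∑∈ S v ≈ ∑∈ S w
  ∑∈-cong {S = S} {v} {w} v≈w = sum-cong-≋ pointwise
    where
    pointwise : ∀ x → (if lookup S x then v x else ε) ≈ (if lookup S x then w x else ε)
    pointwise x with lookup S x in eq
    ... | true  = v≈w (lookup⇒[]= x S eq)
    ... | false = ≈-refl

  ∑∈-0 : {m : ℕ} (S : Subset m) → ∑∈ S (λ _ → ε) ≈ ε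
  ∑∈-0 {m} S = ≈-trans (sum-cong-≋ pointwise) (sum-replicate-zero m)
    where
    pointwise : ∀ x → (if lookup S x then ε else ε) ≈ ε
    pointwise x with lookup S x
    ... | true  = ≈-refl
    ... | false = ≈-refl

  ∑∈-∙ : {m : ℕ} (S : Subset m) (v w : Fin m → Carrier) → ∑∈ S (λ x → v x ∙ w x) ≈ ∑∈ S v ∙ ∑∈ S w
  ∑∈-∙ S v w = ≈-trans (sum-cong-≋ pointwise) (∑-distrib-+ (restrict v) (restrict w))
    where
    restrict : (Fin _ → Carrier) → Fin _ → Carrier
    restrict w x = if lookup S x then w x else ε
    pointwise : ∀ x → restrict (λ y → v y ∙ w y) x ≈ restrict v x ∙ restrict w x
    pointwise x with lookup S x
    ... | true  = ≈-refl
    ... | false = ≈-sym (identityʳ ε)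

  ∑∈-∩ : {m : ℕ} (S X : Subset m) (w : Fin m → Carrier) → ∑∈ S (λ x → if lookup X x then w x else ε) ≡ ∑∈ (S ∩ X) w
  ∑∈-∩ S X w = sum-cong-≗ pointwise
    where
    pointwise : ∀ x → (if lookup S x then (if lookup X x then w x else ε) else ε) ≡ (if lookup (S ∩ X) x then w x else ε)
    pointwise x rewrite lookup-zipWith _∧_ x S X with lookup S x
    ... | true  = refl
    ... | false = refl

  ∑∈-update : {m : ℕ} (S : Subset m) (w : Fin m → Carrier) (i : Fin m) (b : Bool) →
              ∑∈ (S [ i ]≔ b) w ∙ (if lookup S i then w i else ε) ≈ ∑∈ S w ∙ (if b then w i else ε)
  ∑∈-update S w i b = begin
    ∑∈ (S [ i ]≔ b) w ∙ (if lookup S i then w i else ε)           ≈⟨ sum-agree-off i agree ⟩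
    ∑∈ S w ∙ (if lookup (S [ i ]≔ b) i then w i else ε)           ≡⟨ cong (λ c → ∑∈ S w ∙ (if c then w i else ε)) (lookup∘update i S b) ⟩
    ∑∈ S w ∙ (if b then w i else ε)                                ∎
    where
    agree : ∀ j → j ≢ i → (if lookup (S [ i ]≔ b) j then w j else ε) ≈ (if lookup S j then w j else ε)
    agree j j≢i = ≈-reflexive (cong (λ c → if c then w j else ε) (lookup∘update′ j≢i S b))

  ∑∈-swap : {m : ℕ} {S : Subset m} {e f : Fin m} (w : Fin m → Carrier) →
            e ∈ S → f ∉ S → ∑∈ (swap S e f) w ∙ w e ≈ ∑∈ S w ∙ w f
  ∑∈-swap {S = S} {e} {f} w e∈S f∉S = begin
    ∑∈ (swap S e f) w ∙ w e          ≈⟨ ∙-congʳ (≈-sym (identityʳ _)) ⟩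
    (∑∈ (swap S e f) w ∙ ε) ∙ w e    ≈⟨ ∙-congʳ f-added ⟩
    (∑∈ S₀ w ∙ w f) ∙ w e            ≈⟨ solve 3 (λ s x y → (s ⊕ x) ⊕ y ⊜ (s ⊕ y) ⊕ x) ≈-refl (∑∈ S₀ w) (w f) (w e) ⟩
    (∑∈ S₀ w ∙ w e) ∙ w f            ≈⟨ ∙-congʳ e-removed ⟩
    (∑∈ S w ∙ ε) ∙ w f               ≈⟨ ∙-congʳ (identityʳ _) ⟩
    ∑∈ S w ∙ w f                     ∎
    where
    S₀ = S [ e ]≔ outside
    e-removed : ∑∈ S₀ w ∙ w e ≈ ∑∈ S w ∙ ε
    e-removed = subst (λ c → ∑∈ S₀ w ∙ (if c then w e else ε) ≈ ∑∈ S w ∙ ε)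
                      ([]=⇒lookup e∈S) (∑∈-update S w e outside)
    f-added : ∑∈ (swap S e f) w ∙ ε ≈ ∑∈ S₀ w ∙ w f
    f-added = subst (λ c → ∑∈ (swap S e f) w ∙ (if c then w f else ε) ≈ ∑∈ S₀ w ∙ w f)
                    (trans (lookup∘update′ (∈∉⇒≢ e∈S f∉S ∘ sym) S outside) (∉⇒lookup≡false f∉S))
                    (∑∈-update S₀ w f inside)

module ℕΣ = SubsetSum ℕ.+-0-commutativeMonoid
module ℚΣ = SubsetSum +-0-commutativeMonoid

𝟙ℕ : {m : ℕ} → Subset m → Fin m → ℕ
𝟙ℕ X x = if lookup X x then 1 else 0

𝟙ℕ-∈ : {m : ℕ} {X : Subset m} {x : Fin m} → x ∈ X → 𝟙ℕ X x ≡ 1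
𝟙ℕ-∈ x∈X = cong (λ b → if b then 1 else 0) ([]=⇒lookup x∈X)

𝟙ℕ-∉ : {m : ℕ} {X : Subset m} {x : Fin m} → x ∉ X → 𝟙ℕ X x ≡ 0
𝟙ℕ-∉ x∉X = cong (λ b → if b then 1 else 0) (∉⇒lookup≡false x∉X)

∣∣≡∑∈1 : {m : ℕ} (S : Subset m) → ∣ S ∣ ≡ ℕΣ.∑∈ S (λ _ → 1)
∣∣≡∑∈1 []          = refl
∣∣≡∑∈1 (true ∷ S)  = cong suc (∣∣≡∑∈1 S)
∣∣≡∑∈1 (false ∷ S) = ∣∣≡∑∈1 S

∣∩∣-swap : {m : ℕ} {S : Subset m} {e f : Fin m} (X : Subset m) → e ∈ S → f ∉ S →
           ∣ swap S e f ∩ X ∣ ℕ.+ 𝟙ℕ X e ≡ ∣ S ∩ X ∣ ℕ.+ 𝟙ℕ X f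
∣∩∣-swap {S = S} {e} {f} X e∈S f∉S = begin
  ∣ swap S e f ∩ X ∣ ℕ.+ 𝟙ℕ X e        ≡⟨ cong (ℕ._+ 𝟙ℕ X e) (∣∩∣≡∑∈ (swap S e f)) ⟩
  ℕΣ.∑∈ (swap S e f) (𝟙ℕ X) ℕ.+ 𝟙ℕ X e ≡⟨ ℕΣ.∑∈-swap (𝟙ℕ X) e∈S f∉S ⟩
  ℕΣ.∑∈ S (𝟙ℕ X) ℕ.+ 𝟙ℕ X f            ≡⟨ cong (ℕ._+ 𝟙ℕ X f) (sym (∣∩∣≡∑∈ S)) ⟩
  ∣ S ∩ X ∣ ℕ.+ 𝟙ℕ X f                 ∎
  where
  open ≡-Reasoning
  ∣∩∣≡∑∈ : ∀ S → ∣ S ∩ X ∣ ≡ ℕΣ.∑∈ S (𝟙ℕ X)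
  ∣∩∣≡∑∈ S = trans (∣∣≡∑∈1 (S ∩ X)) (sym (ℕΣ.∑∈-∩ S X (λ _ → 1)))

∣swap∩∣≡ : {m : ℕ} {S : Subset m} {e f : Fin m} (X : Subset m) → e ∈ S → f ∉ S → e ∈ X → f ∈ X →
           ∣ swap S e f ∩ X ∣ ≡ ∣ S ∩ X ∣
∣swap∩∣≡ {S = S} {e} {f} X e∈S f∉S e∈X f∈X = ℕ.+-cancelʳ-≡ 1 _ _ (begin
  ∣ swap S e f ∩ X ∣ ℕ.+ 1        ≡⟨ cong (∣ swap S e f ∩ X ∣ ℕ.+_) (sym (𝟙ℕ-∈ e∈X)) ⟩
  ∣ swap S e f ∩ X ∣ ℕ.+ 𝟙ℕ X e   ≡⟨ ∣∩∣-swap X e∈S f∉S ⟩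
  ∣ S ∩ X ∣ ℕ.+ 𝟙ℕ X f            ≡⟨ cong (∣ S ∩ X ∣ ℕ.+_) (𝟙ℕ-∈ f∈X) ⟩
  ∣ S ∩ X ∣ ℕ.+ 1                 ∎)
  where open ≡-Reasoning

∣swap∩∣< : {m : ℕ} {S : Subset m} {e f : Fin m} (X : Subset m) → e ∈ S → f ∉ S → e ∈ X → f ∉ X →
           ∣ swap S e f ∩ X ∣ ℕ.< ∣ S ∩ X ∣
∣swap∩∣< {S = S} {e} {f} X e∈S f∉S e∈X f∉X = ℕ.≤-reflexive (begin
  suc ∣ swap S e f ∩ X ∣          ≡⟨ ℕ.+-comm 1 _ ⟩
  ∣ swap S e f ∩ X ∣ ℕ.+ 1        ≡⟨ cong (∣ swap S e f ∩ X ∣ ℕ.+_) (sym (𝟙ℕ-∈ e∈X)) ⟩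
  ∣ swap S e f ∩ X ∣ ℕ.+ 𝟙ℕ X e   ≡⟨ ∣∩∣-swap X e∈S f∉S ⟩
  ∣ S ∩ X ∣ ℕ.+ 𝟙ℕ X f            ≡⟨ cong (∣ S ∩ X ∣ ℕ.+_) (𝟙ℕ-∉ f∉X) ⟩
  ∣ S ∩ X ∣ ℕ.+ 0                 ≡⟨ ℕ.+-identityʳ _ ⟩
  ∣ S ∩ X ∣                       ∎)
  where open ≡-Reasoning

open +-*-Solver
open import Algebra.Properties.Semiring.Sum (Ring.semiring +-*-ring)
  using (sum; ∑-distrib-+; *-distribˡ-sum; sum-cong-≗)

-- _/_ normalises, so identities between casts are proved in ℚᵘ.

toℚ : ℕ → ℚ
toℚ j = + j / 1

toℚ-suc : ∀ j → toℚ (suc j) ≡ 1ℚ + toℚ j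
toℚ-suc j = toℚᵘ-injective (begin
  toℚᵘ (toℚ (suc j))                ≈⟨ toℚᵘ-fromℚᵘ (mkℚᵘ (+ suc j) 0) ⟩
  mkℚᵘ (+ suc j) 0                  ≈⟨ *≡* (cross-multiply (+ j)) ⟩
  toℚᵘ 1ℚ ℚᵘ.+ mkℚᵘ (+ j) 0         ≈⟨ ℚᵘ.+-congʳ (toℚᵘ 1ℚ) (ℚᵘ.≃-sym (toℚᵘ-fromℚᵘ (mkℚᵘ (+ j) 0))) ⟩
  toℚᵘ 1ℚ ℚᵘ.+ toℚᵘ (toℚ j)         ≈⟨ ℚᵘ.≃-sym (toℚᵘ-homo-+ 1ℚ (toℚ j)) ⟩
  toℚᵘ (1ℚ + toℚ j)                 ∎)
  where
  open ℚᵘ.≃-Reasoning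
  cross-multiply : ∀ (x : ℤ.ℤ) → (+ 1 ℤ.+ x) ℤ.* + 1 ≡ (+ 1 ℤ.* + 1 ℤ.+ x ℤ.* + 1) ℤ.* + 1
  cross-multiply = solve-∀

ratio-*-toℚ : ∀ k d → ratio k (suc d) * toℚ (suc d) ≡ toℚ k
ratio-*-toℚ k d = toℚᵘ-injective (begin
  toℚᵘ (ratio k (suc d) * toℚ (suc d))            ≈⟨ toℚᵘ-homo-* (ratio k (suc d)) (toℚ (suc d)) ⟩
  toℚᵘ (ratio k (suc d)) ℚᵘ.* toℚᵘ (toℚ (suc d))  ≈⟨ ℚᵘ.*-cong (toℚᵘ-fromℚᵘ (mkℚᵘ (+ k) d)) (toℚᵘ-fromℚᵘ (mkℚᵘ (+ suc d) 0)) ⟩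
  mkℚᵘ (+ k) d ℚᵘ.* mkℚᵘ (+ suc d) 0              ≈⟨ *≡* (trans (cross-multiply (+ k) (+ suc d))
                                                               (cong (λ z → + k ℤ.* + suc z) (sym (ℕ.*-identityʳ d)))) ⟩
  mkℚᵘ (+ k) 0                                    ≈⟨ ℚᵘ.≃-sym (toℚᵘ-fromℚᵘ (mkℚᵘ (+ k) 0)) ⟩
  toℚᵘ (toℚ k)                                    ∎)
  where
  open ℚᵘ.≃-Reasoning
  cross-multiply : ∀ (x y : ℤ.ℤ) → (x ℤ.* y) ℤ.* + 1 ≡ x ℤ.* y
  cross-multiply = solve-∀

ratio-unique : ∀ {x} k j → 0 ℕ.< j → x * toℚ j ≡ toℚ k → x ≡ ratio k j
ratio-unique k (suc d) _ eq =
  ≤-antisym (*-cancelʳ-≤-pos (toℚ (suc d)) (≤-reflexive eq′)) (*-cancelʳ-≤-pos (toℚ (suc d)) (≤-reflexive (sym eq′)))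
  where
  instance _ = normalize-pos (suc d) 1
  eq′ = trans eq (sym (ratio-*-toℚ k d))

p≤q⇒0≤q-p : ∀ {p q} → p ≤ q → 0ℚ ≤ q - p
p≤q⇒0≤q-p {p} {q} p≤q = subst (_≤ q - p) (+-inverseʳ p) (+-monoˡ-≤ (- p) p≤q)

+-cancelˡ-≤ : ∀ r {p q} → r + p ≤ r + q → p ≤ q
+-cancelˡ-≤ r {p} {q} r+p≤r+q = subst₂ _≤_ (cancel p) (cancel q) (+-monoʳ-≤ (- r) r+p≤r+q)
  where
  cancel : ∀ x → - r + (r + x) ≡ x
  cancel = solve 2 (λ r x → (:- r) :+ (r :+ x) := x) refl r

p+p≤q+q⇒p≤q : ∀ {p q} → p + p ≤ q + q → p ≤ q
p+p≤q+q⇒p≤q {p} {q} 2p≤2q with p ≤? q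
... | yes p≤q = p≤q
... | no  p≰q = contradiction (≤-<-trans 2p≤2q (+-mono-< q<p q<p)) (<-irrefl refl)
  where q<p = ≰⇒> p≰q

x≤y+εc⇒x≤y : ∀ {w c x y} → 0ℚ < w → 0ℚ ≤ c → (∀ ε → 0ℚ < ε → ε ≤ w → x ≤ y + ε * c) → x ≤ y
x≤y+εc⇒x≤y {w} {c} {x} {y} 0<w 0≤c bound with x ≤? y
... | yes x≤y = x≤y
... | no  x≰y = contradiction (≤-<-trans (bound ε 0<ε (p⊓q≤p w ε₀)) y+εc<x) (<-irrefl refl)
  where
  open ≤-Reasoning
  d = x - y
  c<c+1 : c < c + 1ℚ
  c<c+1 = subst (_< c + 1ℚ) (+-identityʳ c) (+-monoʳ-< c (positive⁻¹ 1ℚ))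
  instance
    d-pos : Positive d
    d-pos = positive (subst (_< d) (+-inverseʳ y) (+-monoˡ-< (- y) (≰⇒> x≰y)))
    c+1-pos : Positive (c + 1ℚ)
    c+1-pos = positive (≤-<-trans 0≤c c<c+1)
    c+1-nonZero : NonZero (c + 1ℚ)
    c+1-nonZero = pos⇒nonZero (c + 1ℚ)
    1/[c+1]-pos : Positive (1/ (c + 1ℚ))
    1/[c+1]-pos = 1/pos⇒pos (c + 1ℚ)
    ε₀-pos : Positive (d * 1/ (c + 1ℚ))
    ε₀-pos = pos*pos⇒pos d (1/ (c + 1ℚ))
  ε₀ ε : ℚ
  ε₀ = d * 1/ (c + 1ℚ)
  ε = w ⊓ ε₀
  0<ε : 0ℚ < ε
  0<ε with ⊓-sel w ε₀
  ... | inj₁ ε≡w  = subst (0ℚ <_) (sym ε≡w) 0<w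
  ... | inj₂ ε≡ε₀ = subst (0ℚ <_) (sym ε≡ε₀) (positive⁻¹ ε₀)
  ε₀*[c+1]≡d : ε₀ * (c + 1ℚ) ≡ d
  ε₀*[c+1]≡d = trans (*-assoc d _ _) (trans (cong (d *_) (*-inverseˡ (c + 1ℚ))) (*-identityʳ d))
  y+εc<x : y + ε * c < x
  y+εc<x = begin-strict
    y + ε * c           ≤⟨ +-monoʳ-≤ y (*-monoʳ-≤-nonNeg c {{nonNegative 0≤c}} (p⊓q≤q w ε₀)) ⟩
    y + ε₀ * c          <⟨ +-monoʳ-< y (*-monoʳ-<-pos ε₀ c<c+1) ⟩
    y + ε₀ * (c + 1ℚ)   ≡⟨ cong (λ z → y + z) ε₀*[c+1]≡d ⟩
    y + (x - y)         ≡⟨ solve 2 (λ x y → y :+ (x :- y) := x) refl x y ⟩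
    x                   ∎

≤-foldr-⊔ : ∀ {m} b (f : Fin m → ℚ) x → f x ≤ Vector.foldr _⊔_ b f
≤-foldr-⊔ b f zero    = p≤p⊔q (f zero) _
≤-foldr-⊔ b f (suc x) = p≤q⇒p≤r⊔q (f zero) (≤-foldr-⊔ b (λ y → f (suc y)) x)

foldr-⊔-attained : ∀ {m} b (f : Fin m → ℚ) → Vector.foldr _⊔_ b f ≡ b ⊎ ∃[ x ] f x ≡ Vector.foldr _⊔_ b f
foldr-⊔-attained {zero}  b f = inj₁ refl
foldr-⊔-attained {suc m} b f with ⊔-sel (f zero) (Vector.foldr _⊔_ b (λ y → f (suc y))) | foldr-⊔-attained b (λ y → f (suc y))
... | inj₁ max≡f0 | _                = inj₂ (zero , sym max≡f0)
... | inj₂ max≡tl | inj₁ tl≡b        = inj₁ (trans max≡tl tl≡b)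
... | inj₂ max≡tl | inj₂ (x , fx≡tl) = inj₂ (suc x , trans fx≡tl (sym max≡tl))

maxE-upper : ∀ {m} (f : Fin (suc m) → ℚ) x → f x ≤ maxE f
maxE-upper f = ≤-foldr-⊔ (f zero) f

maxE-attained : ∀ {m} (f : Fin (suc m) → ℚ) → ∃[ x ] f x ≡ maxE f
maxE-attained f with foldr-⊔-attained (f zero) f
... | inj₁ max≡f0 = zero , sym max≡f0
... | inj₂ attained = attained

∑-nonNeg : {m : ℕ} (f : Fin m → ℚ) → (∀ i → 0ℚ ≤ f i) → 0ℚ ≤ sum f
∑-nonNeg {zero}  f _   = ≤-refl
∑-nonNeg {suc m} f 0≤f =
  subst (_≤ sum f) (+-identityʳ 0ℚ) (+-mono-≤ (0≤f zero) (∑-nonNeg (λ i → f (suc i)) (λ i → 0≤f (suc i))))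

∑-linear : {m : ℕ} (c : ℚ) (x y : Fin m → ℚ) → sum (λ i → x i + c * y i) ≡ sum x + c * sum y
∑-linear c x y = trans (∑-distrib-+ x (λ i → c * y i)) (cong (λ z → sum x + z) (sym (*-distribˡ-sum c y)))

∑-square-shift : {m : ℕ} (a t g : Fin m → ℚ) (ε : ℚ) →
                 sum (λ e → (a e + ε * (t e - g e)) * (a e + ε * (t e - g e))) + ε * (sum (λ e → a e * g e) + sum (λ e → a e * g e))
                 ≡ sum (λ e → a e * a e)
                   + ε * ((sum (λ e → a e * t e) + sum (λ e → a e * t e)) + ε * sum (λ e → (t e - g e) * (t e - g e)))
∑-square-shift a t g ε = begin
  sum F + ε * (sum G + sum G)                     ≡⟨ cong (λ x → sum F + ε * x) (sym (∑-distrib-+ G G)) ⟩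
  sum F + ε * sum (λ e → G e + G e)               ≡⟨ sym (∑-linear ε F (λ e → G e + G e)) ⟩
  sum (λ e → F e + ε * (G e + G e))               ≡⟨ sum-cong-≗ pointwise ⟩
  sum (λ e → P e + ε * ((Q e + Q e) + ε * R e))   ≡⟨ ∑-linear ε P (λ e → (Q e + Q e) + ε * R e) ⟩
  sum P + ε * sum (λ e → (Q e + Q e) + ε * R e)   ≡⟨ cong (λ x → sum P + ε * x) (∑-linear ε (λ e → Q e + Q e) R) ⟩
  sum P + ε * (sum (λ e → Q e + Q e) + ε * sum R) ≡⟨ cong (λ x → sum P + ε * (x + ε * sum R)) (∑-distrib-+ Q Q) ⟩
  sum P + ε * ((sum Q + sum Q) + ε * sum R)       ∎
  where
  open ≡-Reasoning
  F G P Q R : Fin _ → ℚ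
  F e = (a e + ε * (t e - g e)) * (a e + ε * (t e - g e))
  G e = a e * g e
  P e = a e * a e
  Q e = a e * t e
  R e = (t e - g e) * (t e - g e)
  pointwise : ∀ e → F e + ε * (G e + G e) ≡ P e + ε * ((Q e + Q e) + ε * R e)
  pointwise e = solve 4 (λ a ε t g → (a :+ ε :* (t :- g)) :* (a :+ ε :* (t :- g)) :+ ε :* (a :* g :+ a :* g)
                                   := a :* a :+ ε :* ((a :* t :+ a :* t) :+ ε :* ((t :- g) :* (t :- g))))
                        refl (a e) ε (t e) (g e)

𝟙ℚ : {m : ℕ} → Subset m → Fin m → ℚ
𝟙ℚ S x = if lookup S x then 1ℚ else 0ℚ

if-then-0 : ∀ b x → (if b then x else 0ℚ) ≡ x * (if b then 1ℚ else 0ℚ)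
if-then-0 true  x = sym (*-identityʳ x)
if-then-0 false x = sym (*-zeroʳ x)

indicator-diff²-nonNeg : ∀ b c → let δ = (if b then 1ℚ else 0ℚ) - (if c then 1ℚ else 0ℚ) in 0ℚ ≤ δ * δ
indicator-diff²-nonNeg true  true  = ≤-refl
indicator-diff²-nonNeg true  false = nonNegative⁻¹ 1ℚ
indicator-diff²-nonNeg false true  = nonNegative⁻¹ 1ℚ
indicator-diff²-nonNeg false false = ≤-refl

∑∈-const : {m : ℕ} (S : Subset m) (c : ℚ) → ℚΣ.∑∈ S (λ _ → c) ≡ c * toℚ ∣ S ∣
∑∈-const []          c = sym (*-zeroʳ c)
∑∈-const (true ∷ S)  c = begin
  c + ℚΣ.∑∈ S (λ _ → c)    ≡⟨ cong (λ z → c + z) (∑∈-const S c) ⟩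
  c + c * toℚ ∣ S ∣         ≡⟨ solve 2 (λ c s → c :+ c :* s := c :* (con 1ℚ :+ s)) refl c (toℚ ∣ S ∣) ⟩
  c * (1ℚ + toℚ ∣ S ∣)      ≡⟨ cong (c *_) (sym (toℚ-suc ∣ S ∣)) ⟩
  c * toℚ (suc ∣ S ∣)       ∎
  where open ≡-Reasoning
∑∈-const (false ∷ S) c = trans (+-identityˡ _) (∑∈-const S c)

-- Walks and the exchange property of spanning trees

Unique-++⁻ʳ : {A : Set} (xs : List A) {ys : List A} → Unique (xs ++ ys) → Unique ys
Unique-++⁻ʳ []       u       = u
Unique-++⁻ʳ (_ ∷ xs) (_ ∷ u) = Unique-++⁻ʳ xs u

module WalkProperties {n m : ℕ} (ends : Ends n m) where

  open import Data.List.Membership.DecPropositional (_≟ᶠ_ {m}) using () renaming (_∈?_ to _∈ₗ?_)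

  Joins-sym : ∀ {e a b} → Joins ends e a b → Joins ends e b a
  Joins-sym (inj₁ p) = inj₂ p
  Joins-sym (inj₂ p) = inj₁ p

  Joins-unique : ∀ {e a b c d} → Joins ends e a b → Joins ends e c d → (a ≡ c × b ≡ d) ⊎ (a ≡ d × b ≡ c)
  Joins-unique (inj₁ p) (inj₁ q) with trans (sym p) q
  ... | refl = inj₁ (refl , refl)
  Joins-unique (inj₁ p) (inj₂ q) with trans (sym p) q
  ... | refl = inj₂ (refl , refl)
  Joins-unique (inj₂ p) (inj₁ q) with trans (sym p) q
  ... | refl = inj₂ (refl , refl)
  Joins-unique (inj₂ p) (inj₂ q) with trans (sym p) q
  ... | refl = inj₁ (refl , refl)

  Reach : Subset m → Fin n → Fin n → Set
  Reach T a b = ∃[ es ] Walk ends T a b es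

  _++ʷ_ : ∀ {T a b c es fs} → Walk ends T a b es → Walk ends T b c fs → Walk ends T a c (es ++ fs)
  nil         ++ʷ q = q
  cons e∈ j p ++ʷ q = cons e∈ j (p ++ʷ q)

  Walk-split : ∀ {T a c} es {fs} → Walk ends T a c (es ++ fs) → ∃[ b ] Walk ends T a b es × Walk ends T b c fs
  Walk-split []       p             = _ , nil , p
  Walk-split (_ ∷ es) (cons e∈ j p) with Walk-split es p
  ... | b , q , r = b , cons e∈ j q , r

  Walk-rotate : ∀ {T a} es {fs} → Walk ends T a a (es ++ fs) → ∃[ b ] Walk ends T b b (fs ++ es)
  Walk-rotate es p with Walk-split es p
  ... | b , q , r = b , r ++ʷ q

  edges-∈ : ∀ {T a b es} → Walk ends T a b es → All (_∈ T) es
  edges-∈ nil           = []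
  edges-∈ (cons e∈ _ p) = e∈ ∷ edges-∈ p

  Walk-mono : ∀ {T T′ a b es} → All (_∈ T′) es → Walk ends T a b es → Walk ends T′ a b es
  Walk-mono []         nil          = nil
  Walk-mono (e∈ ∷ es∈) (cons _ j p) = cons e∈ j (Walk-mono es∈ p)

  Reach-mono : ∀ {T T′ a b} → (∀ {x} → x ∈ T → x ∈ T′) → Reach T a b → Reach T′ a b
  Reach-mono T⊆T′ (es , p) = es , Walk-mono (All.map T⊆T′ (edges-∈ p)) p

  Reach-refl : ∀ {T a} → Reach T a a
  Reach-refl = [] , nil

  Reach-edge : ∀ {T e a b} → e ∈ T → Joins ends e a b → Reach T a b
  Reach-edge e∈ j = _ , cons e∈ j nil

  Reach-trans : ∀ {T a b c} → Reach T a b → Reach T b c → Reach T a c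
  Reach-trans (_ , p) (_ , q) = _ , p ++ʷ q

  Reach-sym : ∀ {T a b} → Reach T a b → Reach T b a
  Reach-sym (_ , nil)         = Reach-refl
  Reach-sym (_ , cons e∈ j p) = Reach-trans (Reach-sym (_ , p)) (Reach-edge e∈ (Joins-sym j))

  trail-cons : ∀ {T e a b c fs} → e ∈ T → Joins ends e a b → Walk ends T b c fs → Unique fs →
               ∃[ gs ] Walk ends T a c gs × Unique gs
  trail-cons {e = e} {fs = fs} e∈ j p u with e ∈ₗ? fs
  ... | no e∉fs = _ , cons e∈ j p , All.¬Any⇒All¬ fs e∉fs ∷ u
  ... | yes e∈fs with ∈-∃++ e∈fs
  ... | as , bs , refl with Walk-split as p | Unique-++⁻ʳ as u
  ... | _ , _ , cons e∈′ j′ q | u′@(_ ∷ u″) with Joins-unique j j′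
  ... | inj₁ (refl , _) = _ , cons e∈′ j′ q , u′
  ... | inj₂ (refl , _) = _ , q , u″

  trail : ∀ {T a b es} → Walk ends T a b es → ∃[ fs ] Walk ends T a b fs × Unique fs
  trail nil           = _ , nil , []
  trail (cons e∈ j p) with trail p
  ... | _ , q , u = trail-cons e∈ j q u

  -- P need not be decidable, hence the double negation.
  walk-crosses : ∀ {T a b es} (P : Fin n → Set) → Walk ends T a b es → ¬ P a → P b →
                 ¬ ¬ (∃[ f ] ∃[ p ] ∃[ q ] f ∈ T × Joins ends f p q × ¬ P p × P q)
  walk-crosses P nil              ¬Pa Pb _    = ¬Pa Pb
  walk-crosses P (cons f∈ j rest) ¬Pa Pb none = ¬¬-excluded-middle λ
    { (yes Pw) → none (_ , _ , _ , f∈ , j , ¬Pa , Pw)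
    ; (no ¬Pw) → walk-crosses P rest ¬Pw Pb none }

  -- Deleting e splits γ into the vertices joined to u and those joined to v; a
  -- T-walk from v to u crosses between the parts along some f, and γ − e + f is
  -- again a spanning tree.
  module Exchange {γ T : Subset m} (γ-tree : SpanningTree ends γ) (T-connected : ConnectedSub ends T)
                  {e : Fin m} (e∈γ : e ∈ γ) (e∉T : e ∉ T) where

    open Permutation (≡.setoid (Fin m)) using (Unique-resp-↭; ++-comm)

    u v : Fin n
    u = proj₁ (ends e)
    v = proj₂ (ends e)

    γ₀ : Subset m
    γ₀ = γ [ e ]≔ outside

    γ₀⊆γ : ∀ {x} → x ∈ γ₀ → x ∈ γ
    γ₀⊆γ {x} x∈γ₀ with x ≟ᶠ e
    ... | yes refl = ⊥-elim (∉-update-outside e x∈γ₀)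
    ... | no x≢e   = ∈-update⁻ x≢e x∈γ₀

    reaches-u-or-v : ∀ {a es} → Walk ends γ a u es → Reach γ₀ a u ⊎ Reach γ₀ a v
    reaches-u-or-v nil = inj₁ Reach-refl
    reaches-u-or-v (cons {e = e′} e′∈γ j p) with e′ ≟ᶠ e | j
    ... | yes refl | inj₁ eq = inj₁ (subst (λ a → Reach γ₀ a u) (cong proj₁ eq) Reach-refl)
    ... | yes refl | inj₂ eq = inj₂ (subst (λ a → Reach γ₀ a v) (cong proj₂ eq) Reach-refl)
    ... | no e′≢e  | _       = Sum.map (Reach-trans step) (Reach-trans step) (reaches-u-or-v p)
      where step = Reach-edge (∈-update⁺ e′≢e e′∈γ) j

    v-cannot-reach-u : ¬ Reach γ₀ v u
    v-cannot-reach-u (_ , p) with trail p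
    ... | fs , q , uq with proj₂ γ-tree u (e ∷ fs) (cons e∈γ (inj₁ refl) (Walk-mono (All.map γ₀⊆γ (edges-∈ q)) q))
                                         (All.map (λ x∈γ₀ e≡x → ∉-update-outside e (subst (_∈ γ₀) (sym e≡x) x∈γ₀)) (edges-∈ q) ∷ uq)
    ... | ()

    module _ {f : Fin m} {p q : Fin n} (f∈T : f ∈ T) (j : Joins ends f p q)
             (p↛u : ¬ Reach γ₀ p u) (q→u : Reach γ₀ q u) where

      f∉γ₀ : f ∉ γ₀
      f∉γ₀ f∈γ₀ = p↛u (Reach-trans (Reach-edge f∈γ₀ j) q→u)

      f∉γ : f ∉ γ
      f∉γ f∈γ = f∉γ₀ (∈-update⁺ (λ { refl → e∉T f∈T }) f∈γ)

      γ₀⊆swap : ∀ {x} → x ∈ γ₀ → x ∈ swap γ e f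
      γ₀⊆swap x∈γ₀ = ∈-update⁺ (λ { refl → f∉γ₀ x∈γ₀ }) x∈γ₀

      v→u : Reach (swap γ e f) v u
      v→u with reaches-u-or-v (proj₂ (proj₁ γ-tree p u))
      ... | inj₁ p→u = ⊥-elim (p↛u p→u)
      ... | inj₂ p→v = Reach-trans (Reach-mono γ₀⊆swap (Reach-sym p→v))
                         (Reach-trans (Reach-edge (∈-update-inside f) j) (Reach-mono γ₀⊆swap q→u))

      reaches-u : ∀ x → Reach (swap γ e f) x u
      reaches-u x with reaches-u-or-v (proj₂ (proj₁ γ-tree x u))
      ... | inj₁ x→u = Reach-mono γ₀⊆swap x→u
      ... | inj₂ x→v = Reach-trans (Reach-mono γ₀⊆swap x→v) v→u

      swap-connected : ConnectedSub ends (swap γ e f)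
      swap-connected a b = Reach-trans (reaches-u a) (Reach-sym (reaches-u b))

      avoid-f : ∀ {a b es} → Walk ends (swap γ e f) a b es → f ∉ₗ es → Walk ends γ₀ a b es
      avoid-f w f∉es = Walk-mono (All.tabulate λ x∈es → ∈-update⁻ (λ { refl → f∉es x∈es }) (All.lookup (edges-∈ w) x∈es)) w

      swap-acyclic : Acyclic ends (swap γ e f)
      swap-acyclic z es c uq with f ∈ₗ? es
      ... | no f∉es = proj₂ γ-tree z es (Walk-mono (All.map γ₀⊆γ (edges-∈ p₀)) p₀) uq
        where p₀ = avoid-f c f∉es
      ... | yes f∈es with ∈-∃++ f∈es
      ... | as , bs , refl with Walk-rotate as c | Unique-resp-↭ (++-comm as (f ∷ bs)) uq
      ... | _ , cons _ j′ rest | u′ = ⊥-elim (no-γ₀-path (Joins-unique j′ j) (_ , avoid-f rest (Unique[x∷xs]⇒x∉xs u′)))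
        where
        no-γ₀-path : ∀ {x y} → (x ≡ p × y ≡ q) ⊎ (x ≡ q × y ≡ p) → ¬ Reach γ₀ y x
        no-γ₀-path (inj₁ (refl , refl)) q→p = p↛u (Reach-trans (Reach-sym q→p) q→u)
        no-γ₀-path (inj₂ (refl , refl)) p→q = p↛u (Reach-trans p→q q→u)

    exchange : ¬ ¬ (∃[ f ] f ∈ T × f ∉ γ × SpanningTree ends (swap γ e f))
    exchange none = walk-crosses (λ x → Reach γ₀ x u) (proj₂ (T-connected v u)) v-cannot-reach-u Reach-refl
      λ (f , p , q , f∈T , j , p↛u , q→u) → none (f , f∈T , f∉γ f∈T j p↛u q→u ,
                                               swap-connected f∈T j p↛u q→u , swap-acyclic f∈T j p↛u q→u)

-- First-order optimality

Pmf : ℕ → Set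
Pmf m = List (Subset m × ℚ)

module Reweighing {n m : ℕ} (ends : Ends n m) where

  sumℚ-++ : ∀ xs ys → sumℚ ends (xs ++ ys) ≡ sumℚ ends xs + sumℚ ends ys
  sumℚ-++ []       ys = sym (+-identityˡ (sumℚ ends ys))
  sumℚ-++ (x ∷ xs) ys = trans (cong (λ z → x + z) (sumℚ-++ xs ys)) (sym (+-assoc x (sumℚ ends xs) (sumℚ ends ys)))

  η-++ : ∀ (μ ν : Pmf m) e → η ends (μ ++ ν) e ≡ η ends μ e + η ends ν e
  η-++ μ ν e = trans (cong (sumℚ ends) (map-++ usage μ ν)) (sumℚ-++ (map usage μ) (map usage ν))
    where
    usage : Subset m × ℚ → ℚ
    usage p = if lookup (proj₁ p) e then proj₂ p else 0ℚ

  mass-++ : ∀ (μ ν : Pmf m) → sumℚ ends (map proj₂ (μ ++ ν)) ≡ sumℚ ends (map proj₂ μ) + sumℚ ends (map proj₂ ν)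
  mass-++ μ ν = trans (cong (sumℚ ends) (map-++ proj₂ μ ν)) (sumℚ-++ (map proj₂ μ) (map proj₂ ν))

  η-reweigh : ∀ (as bs : Pmf m) γ τ w ε e →
              η ends (as ++ (γ , w - ε) ∷ (τ , ε) ∷ bs) e ≡ η ends (as ++ (γ , w) ∷ bs) e + ε * (𝟙ℚ τ e - 𝟙ℚ γ e)
  η-reweigh as bs γ τ w ε e = begin
    η ends (as ++ (γ , w - ε) ∷ (τ , ε) ∷ bs) e          ≡⟨ η-++ as _ e ⟩
    A + (ite γ (w - ε) + (ite τ ε + B))                  ≡⟨ cong₂ (λ x y → A + (x + (y + B))) (if-then-0 _ (w - ε)) (if-then-0 _ ε) ⟩
    A + ((w - ε) * 𝟙ℚ γ e + (ε * 𝟙ℚ τ e + B))              ≡⟨ solve 6 (λ A B w ε g t → A :+ ((w :- ε) :* g :+ (ε :* t :+ B))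
                                                                          := A :+ (w :* g :+ B) :+ ε :* (t :- g)) refl A B w ε (𝟙ℚ γ e) (𝟙ℚ τ e) ⟩
    A + (w * 𝟙ℚ γ e + B) + ε * (𝟙ℚ τ e - 𝟙ℚ γ e)             ≡⟨ cong (λ x → A + (x + B) + ε * (𝟙ℚ τ e - 𝟙ℚ γ e)) (sym (if-then-0 _ w)) ⟩
    A + (ite γ w + B) + ε * (𝟙ℚ τ e - 𝟙ℚ γ e)               ≡⟨ cong (_+ ε * (𝟙ℚ τ e - 𝟙ℚ γ e)) (sym (η-++ as _ e)) ⟩
    η ends (as ++ (γ , w) ∷ bs) e + ε * (𝟙ℚ τ e - 𝟙ℚ γ e)   ∎
    where
    open ≡-Reasoning
    A = η ends as e
    B = η ends bs e
    ite : Subset m → ℚ → ℚ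
    ite S x = if lookup S e then x else 0ℚ

  isPMF-reweigh : ∀ (as bs : Pmf m) {γ τ w ε} → IsPMF ends (as ++ (γ , w) ∷ bs) → SpanningTree ends τ →
                  0ℚ ≤ ε → ε ≤ w → IsPMF ends (as ++ (γ , w - ε) ∷ (τ , ε) ∷ bs)
  isPMF-reweigh as bs {γ} {τ} {w} {ε} (valid , total) τ-tree 0≤ε ε≤w =
    All.++⁺ (All.++⁻ˡ as valid) ((γ-tree , p≤q⇒0≤q-p ε≤w) ∷ (τ-tree , 0≤ε) ∷ All.tail rest) ,
    (begin
      sumℚ ends (map proj₂ (as ++ (γ , w - ε) ∷ (τ , ε) ∷ bs))  ≡⟨ mass-++ as _ ⟩
      A + ((w - ε) + (ε + B))                                  ≡⟨ solve 4 (λ A B w ε → A :+ ((w :- ε) :+ (ε :+ B)) := A :+ (w :+ B)) refl A B w ε ⟩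
      A + (w + B)                                              ≡⟨ sym (mass-++ as _) ⟩
      sumℚ ends (map proj₂ (as ++ (γ , w) ∷ bs))               ≡⟨ total ⟩
      1ℚ                                                       ∎)
    where
    open ≡-Reasoning
    rest = All.++⁻ʳ as valid
    γ-tree = proj₁ (All.head rest)
    A = sumℚ ends (map proj₂ as)
    B = sumℚ ends (map proj₂ bs)

  cost-reweigh : ∀ (as bs : Pmf m) γ τ w ε → let a = η ends (as ++ (γ , w) ∷ bs) in
                 cost ends (as ++ (γ , w - ε) ∷ (τ , ε) ∷ bs) + ε * (ℚΣ.∑∈ γ a + ℚΣ.∑∈ γ a)
                 ≡ cost ends (as ++ (γ , w) ∷ bs)
                   + ε * ((ℚΣ.∑∈ τ a + ℚΣ.∑∈ τ a) + ε * sum (λ e → (𝟙ℚ τ e - 𝟙ℚ γ e) * (𝟙ℚ τ e - 𝟙ℚ γ e)))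
  cost-reweigh as bs γ τ w ε =
    trans (cong₂ (λ x y → x + ε * (y + y)) (sum-cong-≗ (λ e → cong₂ _*_ (η-reweigh as bs γ τ w ε e) (η-reweigh as bs γ τ w ε e)))
                                           (∑∈-as-sum γ))
   (trans (∑-square-shift a (𝟙ℚ τ) (𝟙ℚ γ) ε)
          (cong (λ y → cost ends (as ++ (γ , w) ∷ bs) + ε * ((y + y) + ε * _)) (sym (∑∈-as-sum τ))))
    where
    a = η ends (as ++ (γ , w) ∷ bs)
    ∑∈-as-sum : ∀ S → ℚΣ.∑∈ S a ≡ sum (λ e → a e * 𝟙ℚ S e)
    ∑∈-as-sum S = sum-cong-≗ (λ e → if-then-0 (lookup S e) (a e))

  support-minWeight : ∀ {μ γ w τ} → Optimal ends μ → (γ , w) ∈ₗ μ → 0ℚ < w → SpanningTree ends τ →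
                      ℚΣ.∑∈ γ (η ends μ) ≤ ℚΣ.∑∈ τ (η ends μ)
  support-minWeight {μ} {γ} {w} {τ} (pmf , optimal) γ∈μ 0<w τ-tree with ∈-∃++ γ∈μ
  ... | as , bs , refl = p+p≤q+q⇒p≤q (x≤y+εc⇒x≤y 0<w 0≤D bound)
    where
    open ≤-Reasoning
    W : Subset m → ℚ
    W S = ℚΣ.∑∈ S (η ends μ)
    D = sum (λ e → (𝟙ℚ τ e - 𝟙ℚ γ e) * (𝟙ℚ τ e - 𝟙ℚ γ e))
    0≤D : 0ℚ ≤ D
    0≤D = ∑-nonNeg _ (λ e → indicator-diff²-nonNeg (lookup τ e) (lookup γ e))
    bound : ∀ ε → 0ℚ < ε → ε ≤ w → W γ + W γ ≤ (W τ + W τ) + ε * D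
    bound ε 0<ε ε≤w = *-cancelˡ-≤-pos ε {{positive 0<ε}} (+-cancelˡ-≤ (cost ends μ) (begin
      cost ends μ + ε * (W γ + W γ)      ≤⟨ +-monoˡ-≤ _ (optimal _ (isPMF-reweigh as bs pmf τ-tree (<⇒≤ 0<ε) ε≤w)) ⟩
      cost ends (as ++ (γ , w - ε) ∷ (τ , ε) ∷ bs) + ε * (W γ + W γ) ≡⟨ cost-reweigh as bs γ τ w ε ⟩
      cost ends μ + ε * ((W τ + W τ) + ε * D) ∎))

-- Minimum weight spanning trees

module MinWeightTrees {n m : ℕ} (ends : Ends n m) (a : Fin m → ℚ) (M : ℚ) (a≤M : ∀ x → a x ≤ M) where

  open WalkProperties ends using (module Exchange)

  E* : Subset m
  E* = argmaxSet a M

  MinWeight : Subset m → Set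
  MinWeight γ = SpanningTree ends γ × (∀ τ → SpanningTree ends τ → ℚΣ.∑∈ γ a ≤ ℚΣ.∑∈ τ a)

  swap-minWeight : ∀ {γ e f} → MinWeight γ → e ∈ γ → e ∈ E* → f ∉ γ → SpanningTree ends (swap γ e f) →
                   f ∈ E* × MinWeight (swap γ e f)
  swap-minWeight {γ} {e} {f} (γ-tree , γ-min) e∈γ e∈E* f∉γ swap-tree =
    f∈E* , swap-tree , λ τ τ-tree → ≤-trans (≤-reflexive (sym same-weight)) (γ-min τ τ-tree)
    where
    exchanged : ℚΣ.∑∈ (swap γ e f) a + a e ≡ ℚΣ.∑∈ γ a + a f
    exchanged = ℚΣ.∑∈-swap a e∈γ f∉γ
    ae≤af : a e ≤ a f
    ae≤af = +-cancelˡ-≤ (ℚΣ.∑∈ γ a) (subst (ℚΣ.∑∈ γ a + a e ≤_) exchanged (+-monoˡ-≤ (a e) (γ-min _ swap-tree)))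
    af≡M : a f ≡ M
    af≡M = ≤-antisym (a≤M f) (subst (_≤ a f) (∈-argmaxSet⁻ a e∈E*) ae≤af)
    f∈E* : f ∈ E*
    f∈E* = ∈-argmaxSet⁺ a af≡M
    same-weight : ℚΣ.∑∈ γ a ≡ ℚΣ.∑∈ (swap γ e f) a
    same-weight = +-cancelʳ-≡ (a f) _ _ (trans (sym exchanged)
                    (cong (λ z → ℚΣ.∑∈ (swap γ e f) a + z) (trans (∈-argmaxSet⁻ a e∈E*) (sym af≡M))))

  minWeight-cover : ∀ {γ T} → MinWeight γ → ConnectedSub ends T → ∣ γ ∩ E* ∣ ℕ.≤ ∣ T ∩ E* ∣
  minWeight-cover {T = T} γ-min T-connected = go γ-min (<-wellFounded _)
    where
    go : ∀ {γ} → MinWeight γ → Acc ℕ._<_ ∣ γ ∩ ∁ T ∣ → ∣ γ ∩ E* ∣ ℕ.≤ ∣ T ∩ E* ∣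
    go {γ} γ-min (acc smaller) with nonempty? ((γ ∩ E*) ∩ ∁ T)
    ... | no none = p⊆q⇒∣p∣≤∣q∣ γ∩E*⊆T∩E*
      where
      γ∩E*⊆T∩E* : γ ∩ E* ⊆ T ∩ E*
      γ∩E*⊆T∩E* {x} x∈γ∩E* with x ∈? T
      ... | yes x∈T = x∈p∩q⁺ (x∈T , proj₂ (x∈p∩q⁻ γ E* x∈γ∩E*))
      ... | no  x∉T = contradiction (x , x∈p∩q⁺ (x∈γ∩E* , x∉p⇒x∈∁p x∉T)) none
    ... | yes (e , e∈) = decidable-stable (∣ γ ∩ E* ∣ ℕ.≤? ∣ T ∩ E* ∣) λ γ≰T →
          Exchange.exchange (proj₁ γ-min) T-connected e∈γ e∉T λ (f , f∈T , f∉γ , swap-tree) →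
          γ≰T (recurse f∈T f∉γ swap-tree)
      where
      e∈γ∩E* = proj₁ (x∈p∩q⁻ (γ ∩ E*) (∁ T) e∈)
      e∈γ  = proj₁ (x∈p∩q⁻ γ E* e∈γ∩E*)
      e∈E* = proj₂ (x∈p∩q⁻ γ E* e∈γ∩E*)
      e∉T  = x∈∁p⇒x∉p (proj₂ (x∈p∩q⁻ (γ ∩ E*) (∁ T) e∈))
      recurse : ∀ {f} → f ∈ T → f ∉ γ → SpanningTree ends (swap γ e f) → ∣ γ ∩ E* ∣ ℕ.≤ ∣ T ∩ E* ∣
      recurse {f} f∈T f∉γ swap-tree =
        subst (ℕ._≤ ∣ T ∩ E* ∣) (∣swap∩∣≡ E* e∈γ f∉γ e∈E* (proj₁ swapped))
              (go (proj₂ swapped) (smaller (∣swap∩∣< (∁ T) e∈γ f∉γ (x∉p⇒x∈∁p e∉T) (x∈p⇒x∉∁p f∈T))))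
        where swapped = swap-minWeight γ-min e∈γ e∈E* f∉γ swap-tree

-- Double counting

module Counting {n m : ℕ} (ends : Ends n m) where

  ∑∈-η : ∀ (X : Subset m) (μ : Pmf m) → ℚΣ.∑∈ X (η ends μ) ≡ sumℚ ends (map (λ p → proj₂ p * toℚ ∣ proj₁ p ∩ X ∣) μ)
  ∑∈-η X []            = ℚΣ.∑∈-0 X
  ∑∈-η X ((γ , w) ∷ μ) = begin
    ℚΣ.∑∈ X (λ e → ite e + η ends μ e)              ≡⟨ ℚΣ.∑∈-∙ X ite (η ends μ) ⟩
    ℚΣ.∑∈ X ite + ℚΣ.∑∈ X (η ends μ)                ≡⟨ cong₂ _+_ (ℚΣ.∑∈-∩ X γ (λ _ → w)) (∑∈-η X μ) ⟩
    ℚΣ.∑∈ (X ∩ γ) (λ _ → w) + _                      ≡⟨ cong (_+ _) (trans (∑∈-const (X ∩ γ) w) (cong (λ S → w * toℚ ∣ S ∣) (∩-comm X γ))) ⟩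
    w * toℚ ∣ γ ∩ X ∣ + _                            ∎
    where
    open ≡-Reasoning
    ite : Fin m → ℚ
    ite e = if lookup γ e then w else 0ℚ

  sumℚ-*ʳ : ∀ (μ : Pmf m) c → sumℚ ends (map (λ p → proj₂ p * c) μ) ≡ sumℚ ends (map proj₂ μ) * c
  sumℚ-*ʳ []      c = sym (*-zeroˡ c)
  sumℚ-*ʳ (p ∷ μ) c = trans (cong (λ z → proj₂ p * c + z) (sumℚ-*ʳ μ c)) (sym (*-distribʳ-+ c (proj₂ p) _))

  ∑∈-η-support : ∀ (X : Subset m) {μ : Pmf m} k → IsPMF ends μ →
                 (∀ {γ w} → (γ , w) ∈ₗ μ → 0ℚ < w → ∣ γ ∩ X ∣ ≡ k) → ℚΣ.∑∈ X (η ends μ) ≡ toℚ k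
  ∑∈-η-support X {μ} k (valid , total) support = begin
    ℚΣ.∑∈ X (η ends μ)                                       ≡⟨ ∑∈-η X μ ⟩
    sumℚ ends (map (λ p → proj₂ p * toℚ ∣ proj₁ p ∩ X ∣) μ)  ≡⟨ cong (sumℚ ends) (map-cong-local (All.tabulate term≡)) ⟩
    sumℚ ends (map (λ p → proj₂ p * toℚ k) μ)                ≡⟨ sumℚ-*ʳ μ (toℚ k) ⟩
    sumℚ ends (map proj₂ μ) * toℚ k                          ≡⟨ cong (_* toℚ k) total ⟩
    1ℚ * toℚ k                                               ≡⟨ *-identityˡ (toℚ k) ⟩
    toℚ k                                                    ∎
    where
    open ≡-Reasoning
    term≡ : ∀ {p} → p ∈ₗ μ → proj₂ p * toℚ ∣ proj₁ p ∩ X ∣ ≡ proj₂ p * toℚ k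
    term≡ {γ , w} p∈μ with <-cmp 0ℚ w
    ... | tri< 0<w _ _ = cong (λ j → w * toℚ j) (support p∈μ 0<w)
    ... | tri≈ _ refl _ = trans (*-zeroˡ (toℚ ∣ γ ∩ X ∣)) (sym (*-zeroˡ (toℚ k)))
    ... | tri> _ _ w<0 = contradiction (<-≤-trans w<0 (proj₂ (All.lookup valid p∈μ))) (<-irrefl refl)

lemma5 : (n m : ℕ) (ends : Ends n (suc m)) → NoLoops ends →
         Connected ends →
         (μ : List (Subset (suc m) × ℚ)) → Optimal ends μ →
         (k : ℕ) → IsMinCover ends (argmaxSet (η ends μ) (maxE (η ends μ))) k →
         maxE (η ends μ) ≡ θ (argmaxSet (η ends μ) (maxE (η ends μ))) k
lemma5 n m ends _ _ μ optimal k ((T₀ , T₀-tree , ∣T₀∩E*∣≡k) , k≤∣T∩E*∣) =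
  ratio-unique k ∣ E* ∣ (∈⇒0<∣∣ (∈-argmaxSet⁺ a (proj₂ (maxE-attained a)))) (begin
    M * toℚ ∣ E* ∣        ≡⟨ sym (∑∈-const E* M) ⟩
    ℚΣ.∑∈ E* (λ _ → M)    ≡⟨ ℚΣ.∑∈-cong (λ x∈E* → sym (∈-argmaxSet⁻ a x∈E*)) ⟩
    ℚΣ.∑∈ E* a            ≡⟨ ∑∈-η-support E* k (proj₁ optimal) support ⟩
    toℚ k                 ∎)
  where
  open ≡-Reasoning
  open Reweighing ends using (support-minWeight)
  open Counting ends using (∑∈-η-support)
  a = η ends μ
  M = maxE a
  open MinWeightTrees ends a M (maxE-upper a)
  support : ∀ {γ w} → (γ , w) ∈ₗ μ → 0ℚ < w → ∣ γ ∩ E* ∣ ≡ k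
  support γ∈μ 0<w = ℕ.≤-antisym
    (ℕ.≤-trans (minWeight-cover (γ-tree , λ _ τ-tree → support-minWeight optimal γ∈μ 0<w τ-tree) (proj₁ T₀-tree))
               (ℕ.≤-reflexive ∣T₀∩E*∣≡k))
    (k≤∣T∩E*∣ _ γ-tree)
    where
    γ-tree = proj₁ (All.lookup (proj₁ (proj₁ optimal)) γ∈μ)
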